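{- Let $B$ be a predomain base for which $\ll$ is decidable and let $C$ be a bounded complete predomain base. Let $I$ be a finite set, $\alpha,\gamma_i\in B$ and $\beta,\delta_i\in C$ ($i\in I$), and let $\bigsqcup_{i\in I}\gamma_i\searrow\delta_i$ be a step function. Then the following are equivalent: (1) $\alpha\searrow\beta\sqsubseteq\bigsqcup_{i\in I}\gamma_i\searrow\delta_i$; (2) for all $x\in B$ with $\alpha\ll x$ we have $\beta\sqsubseteq\bigsqcup\{\delta_i\mid i\in I,\ \gamma_i\ll x\}$; (3) for every $I_0\subseteq I$ such that $A=\{\alpha\}\cup\{\gamma_i\mid i\in I_0\}$ and $D=\{\gamma_i\mid i\notin I_0\}$ are separated, we have $\beta\sqsubseteq\bigsqcup\{\delta_i\mid i\in I_0\}$.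
   Context: Work constructively; $\tilde\exists x.A$ abbreviates $\neg\forall x.\neg A$. In a poset, a chain is a sequence $(x_n)$ with $x_n\sqsubseteq x_{n+1}$; $b\ll c$ means: for every chain $(x_n)$ whose supremum exists with $c\sqsubseteq\bigsqcup_n x_n$, there weakly exists $n$ with $b\sqsubseteq x_n$. An approximating sequence of $b$ is a chain $(b_n)$ with $b_n\ll b$ for all $n$ and $\bigsqcup_n b_n=b$. A predomain base is a countable poset with decidable order in which every element has an approximating sequence. A nonempty finite subset is consistent if it weakly has an upper bound; a predomain base is bounded complete if every finite consistent subset has a least upper bound (a nonempty bounded complete base has a least element $\bot$, and $\bigsqcup\emptyset=\bot$). For $b\in B$, $c\in C$, the single step function $b\searrow c$ is the function $B\to C$ with $(b\searrow c)(x)=c$ if $b\ll x$ and $=\bot$ otherwise. A step function is a finite family $\{b_i\searrow c_i\}_{i\in I}$, written $\bigsqcup_{i\in I}b_i\searrow c_i$, such that for every nonempty $J\subseteq I$, if $\{b_j\mid j\in J\}$ is consistent then $\{c_j\mid j\in J\}$ is consistent; it denotes the function $x\mapsto\bigsqcup_{i\in I}(b_i\searrow c_i)(x)$. (Single) step functions are ordered by $s\sqsubseteq t$ iff $s(x)\sqsubseteq t(x)$ for all $x\in B$. Two subsets $A,D\subseteq B$ are separated if there weakly exists $\omega\in B$ with $a\ll\omega$ for all $a\in A$ and $\neg(d\ll\omega)$ for all $d\in D$. -}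

module Defs where

open import Data.Nat using (ℕ; suc)
open import Data.Fin using (Fin)
open import Data.Fin.Subset using (Subset; _∈_; Nonempty)
open import Data.Maybe using (Maybe; just)
open import Data.Product using (Σ; ∃; _×_; _,_; proj₁)
open import Data.Empty using (⊥-elim)
open import Relation.Nullary using (¬_; Dec; yes; no)
open import Relation.Binary.PropositionalEquality using (_≡_)

-- A countable poset with decidable order (the data underlying a predomain base).
-- Countable: there is an enumeration ℕ → Maybe Carrier hitting every element
-- (the Maybe allows the empty poset).
record Base : Set₁ where
  field
    Carrier  : Set
    _⊑_      : Carrier → Carrier → Set
    ⊑-refl   : ∀ x → x ⊑ x
    ⊑-trans  : ∀ {x y z} → x ⊑ y → y ⊑ z → x ⊑ z
    ⊑-antisym : ∀ {x y} → x ⊑ y → y ⊑ x → x ≡ y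
    ⊑-dec    : ∀ x y → Dec (x ⊑ y)
    enum     : ℕ → Maybe Carrier
    enum-surj : ∀ x → ∃ λ n → enum n ≡ just x

module Notions (B : Base) where
  open Base B

  IsChain : (ℕ → Carrier) → Set
  IsChain x = ∀ n → x n ⊑ x (suc n)

  IsUB : (Carrier → Set) → Carrier → Set
  IsUB P u = ∀ y → P y → y ⊑ u

  IsLub : (Carrier → Set) → Carrier → Set
  IsLub P s = IsUB P s × (∀ u → IsUB P u → s ⊑ u)

  IsSup : (ℕ → Carrier) → Carrier → Set
  IsSup x s = IsLub (λ y → ∃ λ n → x n ≡ y) s

  _≪_ : Carrier → Carrier → Set
  b ≪ c = ∀ (x : ℕ → Carrier) → IsChain x → ∀ s → IsSup x s → c ⊑ s →
          ¬ (∀ n → ¬ (b ⊑ x n))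

  record ApproxSeq (b : Carrier) : Set where
    field
      seq      : ℕ → Carrier
      seq-chain : IsChain seq
      seq-≪    : ∀ n → seq n ≪ b
      seq-sup  : IsSup seq b

  Image : ∀ {n} → (Fin n → Carrier) → Carrier → Set
  Image {n} f y = ∃ λ (i : Fin n) → f i ≡ y

  ImageOn : ∀ {n} → Subset n → (Fin n → Carrier) → Carrier → Set
  ImageOn {n} J f y = ∃ λ (i : Fin n) → i ∈ J × f i ≡ y

  Consistent : (Carrier → Set) → Set
  Consistent P = ¬ ¬ (Σ Carrier λ u → IsUB P u)

  -- bounded complete: every finite consistent subset has a least upper bound
  -- (finite subsets = images of families indexed by Fin n; n = 0 gives ⊔∅ = ⊥)
  BoundedComplete : Set
  BoundedComplete = ∀ n (f : Fin n → Carrier) → Consistent (Image f) →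
                    Σ Carrier λ s → IsLub (Image f) s

  -- the least element ⊥ of a nonempty bounded complete base (= ⊔∅)
  bot : BoundedComplete → Carrier → Carrier
  bot bc c = proj₁ (bc 0 (λ ()) (λ k → k (c , λ { y (() , _) })))

  Separated : (Carrier → Set) → (Carrier → Set) → Set
  Separated A D = ¬ ¬ (Σ Carrier λ ω → (∀ a → A a → a ≪ ω) × (∀ d → D d → ¬ (d ≪ ω)))

record PredomainBase : Set₁ where
  field
    base   : Base
  open Base base public
  open Notions base public
  field
    approx : ∀ b → ApproxSeq b

module StepFunctions (B C : PredomainBase) where
  private
    module B = PredomainBase B
    module C = PredomainBase C

  single : (∀ x y → Dec (x B.≪ y)) → C.Carrier →
           B.Carrier → C.Carrier → B.Carrier → C.Carrier
  single dec ⊥C b c x with dec b x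
  ... | yes _ = c
  ... | no  _ = ⊥C

  IsStepFunction : ∀ n → (Fin n → B.Carrier) → (Fin n → C.Carrier) → Set
  IsStepFunction n γ δ = ∀ (J : Subset n) → Nonempty J →
    B.Consistent (B.ImageOn J γ) → C.Consistent (C.ImageOn J δ)

module Submission where

-- Suprema are supplied as hypotheses (IsLub), so the argument is
-- order-theoretic bookkeeping around three facts established first:
--   * lubs only depend on the set of upper bounds (lub-of-same-ubs, lub-cong);
--   * a single step value b ↘ c at x lies below u iff (b ≪ x → c ⊑ u)
--     (step-below), using that ⊥ = ⊔∅ is least (bot-least);
--   * ω separates {α} ∪ γ[I₀] from γ[∁I₀] iff α ≪ ω and I₀ is exactly the set of
--     "active" indices {i | γᵢ ≪ ω} (separates⇔), which exists as a finite subset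
--     because ≪ is decidable (subsetOf).
-- Then (1) ⇔ (2) holds pointwise in x, and (2) ⇔ (3) by taking I₀ = active x,
-- resp. x = a separating ω; the weak existential of separation is eliminated
-- because the conclusion β ⊑ v is decidable.

open import Defs
open import Data.Nat using (ℕ)
open import Data.Fin using (Fin)
open import Data.Fin.Subset using (Subset; _∈_; _∉_)
open import Data.Fin.Subset.Properties using (_∈?_)
open import Data.Product using (∃; _×_; _,_; proj₂)
open import Data.Sum using (_⊎_; inj₁; inj₂)
open import Data.Bool.Properties using (T-≡)
open import Data.Empty using (⊥-elim)
open import Data.Vec using (tabulate)
open import Data.Vec.Properties using (lookup∘tabulate; lookup⇒[]=; []=⇒lookup)
open import Relation.Nullary using (¬_; Dec; yes; no)
open import Relation.Nullary.Decidable using (isYes; toWitness; fromWitness; decidable-stable)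
open import Relation.Binary.PropositionalEquality using (_≡_; refl; sym; trans)
open import Function.Bundles using (_⇔_; mk⇔; Equivalence)
import Function.Properties.Equivalence as ⇔

open Equivalence using (to; from)

module LubFacts (B : Base) where
  open Base B
  open Notions B

  lub-of-same-ubs : ∀ {P Q : Carrier → Set} {v} →
    (∀ u → IsUB P u ⇔ IsUB Q u) → IsLub P v → IsLub Q v
  lub-of-same-ubs ubs (v-ub , v-least) =
    to (ubs _) v-ub , λ u u-ub → v-least u (from (ubs u) u-ub)

  lub-cong : ∀ {P Q : Carrier → Set} {v} →
    (∀ y → P y → Q y) → (∀ y → Q y → P y) → IsLub P v → IsLub Q v
  lub-cong P⊆Q Q⊆P = lub-of-same-ubs λ u →
    mk⇔ (λ u-ub y q → u-ub y (Q⊆P y q)) (λ u-ub y p → u-ub y (P⊆Q y p))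

  bot-least : (bc : BoundedComplete) (c : Carrier) → ∀ u → bot bc c ⊑ u
  bot-least bc c u = proj₂ (proj₂ (bc 0 _ _)) u λ { _ (() , _) }

module _ {n : ℕ} {P : Fin n → Set} (P? : ∀ i → Dec (P i)) where

  subsetOf : Subset n
  subsetOf = tabulate (λ i → isYes (P? i))

  ∈-subsetOf : ∀ i → i ∈ subsetOf ⇔ P i
  ∈-subsetOf i = mk⇔
    (λ i∈ → toWitness (from T-≡ (trans (sym (lookup∘tabulate _ i)) ([]=⇒lookup i∈))))
    (λ p → lookup⇒[]= i subsetOf (trans (lookup∘tabulate _ i) (to T-≡ (fromWitness p))))

module SingleStep (B C : PredomainBase) (dec≪ : ∀ x y → Dec (PredomainBase._≪_ B x y))
    (⊥C : PredomainBase.Carrier C) (⊥-least : ∀ u → PredomainBase._⊑_ C ⊥C u) where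
  private
    module B = PredomainBase B
    module C = PredomainBase C
  open StepFunctions B C

  step-below : ∀ b c x u → single dec≪ ⊥C b c x C.⊑ u ⇔ (b B.≪ x → c C.⊑ u)
  step-below b c x u with dec≪ b x
  ... | yes b≪x = mk⇔ (λ c⊑u _ → c⊑u) (λ h → h b≪x)
  ... | no  b≪̸x = mk⇔ (λ _ b≪x → ⊥-elim (b≪̸x b≪x)) (λ _ → ⊥-least u)

module Theorem (B C : PredomainBase)
    (dec≪ : ∀ x y → Dec (PredomainBase._≪_ B x y))
    (bcC : PredomainBase.BoundedComplete C)
    (n : ℕ) (α : PredomainBase.Carrier B) (β : PredomainBase.Carrier C)
    (γ : Fin n → PredomainBase.Carrier B) (δ : Fin n → PredomainBase.Carrier C) where
  module B = PredomainBase B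
  module C = PredomainBase C
  open StepFunctions B C
  open LubFacts C.base
  ⊥C = C.bot bcC β
  step = single dec≪ ⊥C
  open SingleStep B C dec≪ ⊥C (bot-least bcC β)

  Active : B.Carrier → C.Carrier → Set
  Active x y = ∃ λ (i : Fin n) → γ i B.≪ x × δ i ≡ y

  Inside Outside : Subset n → B.Carrier → Set
  Inside  I₀ a = a ≡ α ⊎ B.ImageOn I₀ γ a
  Outside I₀ d = ∃ λ (i : Fin n) → i ∉ I₀ × γ i ≡ d

  Separates : Subset n → B.Carrier → Set
  Separates I₀ ω = (∀ a → Inside I₀ a → a B.≪ ω) × (∀ d → Outside I₀ d → ¬ (d B.≪ ω))

  cond1 = ∀ (x : B.Carrier) (v : C.Carrier)
          → C.IsLub (C.Image (λ i → step (γ i) (δ i) x)) v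
          → step α β x C.⊑ v
  cond2 = ∀ (x : B.Carrier) → α B.≪ x → ∀ (v : C.Carrier)
          → C.IsLub (Active x) v
          → β C.⊑ v
  cond3 = ∀ (I₀ : Subset n)
          → B.Separated (Inside I₀) (Outside I₀)
          → ∀ (v : C.Carrier) → C.IsLub (C.ImageOn I₀ δ) v
          → β C.⊑ v

  -- Upper bounds of the values of the steps at x are those of the active δᵢ,
  -- because inactive steps contribute only ⊥.
  steps-ubs : ∀ x u → C.IsUB (C.Image (λ i → step (γ i) (δ i) x)) u ⇔ C.IsUB (Active x) u
  steps-ubs x u = mk⇔
    (λ { u-ub _ (i , γᵢ≪x , refl) → to (step-below (γ i) (δ i) x u) (u-ub _ (i , refl)) γᵢ≪x })
    (λ { u-ub _ (i , refl) → from (step-below (γ i) (δ i) x u) λ γᵢ≪x → u-ub _ (i , γᵢ≪x , refl) })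

  separates⇔ : ∀ I₀ ω → Separates I₀ ω ⇔ (α B.≪ ω × (∀ i → i ∈ I₀ ⇔ γ i B.≪ ω))
  separates⇔ I₀ ω = mk⇔
    (λ (inside≪ , outside≪̸) → inside≪ α (inj₁ refl) , λ i → mk⇔
      (λ i∈ → inside≪ (γ i) (inj₂ (i , i∈ , refl)))
      (λ γᵢ≪ω → decidable-stable (i ∈? I₀) λ i∉ → outside≪̸ (γ i) (i , i∉ , refl) γᵢ≪ω))
    (λ (α≪ω , active) →
      (λ { _ (inj₁ refl) → α≪ω ; _ (inj₂ (i , i∈ , refl)) → to (active i) i∈ }) ,
      (λ { _ (i , i∉ , refl) γᵢ≪ω → i∉ (from (active i) γᵢ≪ω) }))

  lub-active : ∀ {I₀ ω v} → (∀ i → i ∈ I₀ ⇔ γ i B.≪ ω) →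
    C.IsLub (C.ImageOn I₀ δ) v ⇔ C.IsLub (Active ω) v
  lub-active active = mk⇔
    (lub-cong (λ { _ (i , i∈ , refl) → i , to (active i) i∈ , refl })
              (λ { _ (i , γᵢ≪ω , refl) → i , from (active i) γᵢ≪ω , refl }))
    (lub-cong (λ { _ (i , γᵢ≪ω , refl) → i , from (active i) γᵢ≪ω , refl })
              (λ { _ (i , i∈ , refl) → i , to (active i) i∈ , refl }))

  cond1⇔cond2 : cond1 ⇔ cond2
  cond1⇔cond2 = mk⇔
    (λ c1 x α≪x v lub → to (step-below α β x v)
      (c1 x v (lub-of-same-ubs (λ u → ⇔.sym (steps-ubs x u)) lub)) α≪x)
    (λ c2 x v lub → from (step-below α β x v) λ α≪x →
      c2 x α≪x v (lub-of-same-ubs (steps-ubs x) lub))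

  -- (2) ⇔ (3): a separating ω is a point above α whose active set is I₀, and
  -- conversely a point x above α separates its own active set.
  cond2⇔cond3 : cond2 ⇔ cond3
  cond2⇔cond3 = mk⇔
    (λ c2 I₀ separated v lub → decidable-stable (C.⊑-dec β v) λ β⋢v →
      separated λ (ω , sep) → let (α≪ω , active) = to (separates⇔ I₀ ω) sep in
        β⋢v (c2 ω α≪ω v (to (lub-active active) lub)))
    (λ c3 x α≪x v lub → let active = ∈-subsetOf (λ i → dec≪ (γ i) x) in
      c3 _ (λ ¬sep → ¬sep (x , from (separates⇔ _ x) (α≪x , active)))
         v (from (lub-active active) lub))

theorem5p6 : (B C : PredomainBase)
    → (dec≪ : ∀ x y → Dec (PredomainBase._≪_ B x y))
    → (bcC : PredomainBase.BoundedComplete C)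
    → (n : ℕ) (α : PredomainBase.Carrier B) (β : PredomainBase.Carrier C)
    → (γ : Fin n → PredomainBase.Carrier B) (δ : Fin n → PredomainBase.Carrier C)
    → StepFunctions.IsStepFunction B C n γ δ
    → let open StepFunctions B C
          module B = PredomainBase B
          module C = PredomainBase C
          ⊥C = C.bot bcC β
          step = single dec≪ ⊥C
          cond1 = ∀ (x : B.Carrier) (v : C.Carrier)
                  → C.IsLub (C.Image (λ i → step (γ i) (δ i) x)) v
                  → step α β x C.⊑ v
          cond2 = ∀ (x : B.Carrier) → α B.≪ x → ∀ (v : C.Carrier)
                  → C.IsLub (λ y → ∃ λ (i : Fin n) → γ i B.≪ x × δ i ≡ y) v
                  → β C.⊑ v
          cond3 = ∀ (I₀ : Subset n)
                  → B.Separated (λ a → a ≡ α ⊎ B.ImageOn I₀ γ a)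
                                (λ d → ∃ λ (i : Fin n) → i ∉ I₀ × γ i ≡ d)
                  → ∀ (v : C.Carrier) → C.IsLub (C.ImageOn I₀ δ) v
                  → β C.⊑ v
      in (cond1 ⇔ cond2) × (cond1 ⇔ cond3)
theorem5p6 B C dec≪ bcC n α β γ δ _ =
  cond1⇔cond2 , ⇔.trans cond1⇔cond2 cond2⇔cond3
  where open Theorem B C dec≪ bcC n α β γ δ
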